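{- Let $T$ be a tour in a complete graph and let $T_1$ and $T_2$ be two successive sub-paths of $T$, each containing an even number of edges. Any two 2-changes on $T$, each formed by removing one edge of $T_1$ and one edge in an even position along $T_2$, are chord-disjoint.
   Context: A tour is a Hamiltonian cycle; its edges are tour-edges, the other edges chord-edges. A 2-change $S_T(e,f)$ on $T$, for two non-adjacent tour-edges $e,f$, removes $e,f$ and adds the unique two chord-edges that reconnect the result into a new tour. Two 2-changes are chord-disjoint if they add no common chord-edge. "Successive" means $T_2$ directly follows $T_1$ along $T$ (in a fixed traversal direction); positions along $T_2$ are counted in order along the traversal. -}

module Defs where

open import Data.Nat using (ℕ; suc; _≤_; _<_; _%_; NonZero; >-nonZero; s≤s; z≤n)
open import Data.Nat.DivMod using (m%n<n)
open import Data.Fin using (Fin; fromℕ<)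
open import Data.Product using (_×_; _,_; proj₁; proj₂)
open import Data.Sum using (_⊎_)
open import Data.List using (List; _∷_; [])
open import Data.List.Membership.Propositional using (_∈_)
open import Relation.Binary.PropositionalEquality using (_≡_; _≢_)
open import Relation.Nullary using (¬_)
open import Function.Definitions using (Injective; Surjective)

-- A tour (Hamiltonian cycle) in the complete graph on vertex set V (|V| = n ≥ 3):
-- a cyclic enumeration vtx 0, vtx 1, …, vtx (n-1) of all vertices, each exactly once.
-- Tour-edges are {vtx i, vtx (i+1 mod n)}.
record Tour (V : Set) (n : ℕ) : Set where
  field
    three≤n : 3 ≤ n
    vtx     : Fin n → V
    inj     : Injective _≡_ _≡_ vtx
    surj    : Surjective _≡_ _≡_ vtx

module _ {V : Set} {n : ℕ} (T : Tour V n) where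
  open Tour T

  private
    instance
      nz : NonZero n
      nz = >-nonZero (lemma three≤n)
        where
        lemma : 3 ≤ n → 0 < n
        lemma (s≤s _) = s≤s z≤n

  at : ℕ → V
  at p = vtx (fromℕ< (m%n<n p n))

  -- the tour-edge at position p is {at p , at (p+1)}; two tour-edges at
  -- positions p, q are distinct and non-adjacent (share no endpoint)
  NonAdjacent : ℕ → ℕ → Set
  NonAdjacent p q = (p % n ≢ q % n) × (suc p % n ≢ q % n) × (suc q % n ≢ p % n)

  Edge : Set
  Edge = V × V

  _≐_ : Edge → Edge → Set
  e ≐ f = (proj₁ e ≡ proj₁ f × proj₂ e ≡ proj₂ f) ⊎ (proj₁ e ≡ proj₂ f × proj₂ e ≡ proj₁ f)

  -- The two chord-edges added by the 2-change S_T(e,f) removing the tour-edges at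
  -- positions p and q: {at p, at q} and {at (p+1), at (q+1)} (the unique
  -- reconnection into a new tour).
  chords : ℕ → ℕ → List Edge
  chords p q = (at p , at q) ∷ (at (suc p) , at (suc q)) ∷ []

  ChordDisjoint : ℕ → ℕ → ℕ → ℕ → Set
  ChordDisjoint p q p' q' =
    ∀ c c' → c ∈ chords p q → c' ∈ chords p' q' → ¬ (c ≐ c')

-- Measure positions as offsets from the first tour-edge of T₁ and put a cut at the vertex
-- between T₁ and T₂. Every chord added by one of these 2-changes joins a vertex at or before
-- the cut to one after it, and its two endpoints lie less than n apart, so its offsets are
-- read off from its endpoints. Hence two such 2-changes share a chord only if they coincide
-- or their second removed edges are consecutive; the latter is excluded because every edge
-- at an even position of T₂ sits at an odd offset.
module Submission where

open import Defs
open import Data.Nat using (ℕ; zero; suc; _+_; _*_; _∸_; _%_; _/_; _≤_; _<_; NonZero; >-nonZero; s≤s; z≤n)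
open import Data.Nat.Properties
open import Data.Nat.DivMod using (m≡m%n+[m/n]*n)
open import Data.Nat.Divisibility using (_∣_; divides; >⇒∤)
open import Data.Fin using (toℕ)
open import Data.Fin.Properties using (toℕ-fromℕ<)
open import Data.Product using (_×_; _,_; proj₁; proj₂)
open import Data.Sum using (_⊎_; inj₁; inj₂)
open import Data.List.Membership.Propositional using (_∈_)
open import Data.List.Relation.Unary.Any using (here; there)
open import Relation.Binary.PropositionalEquality
open import Relation.Nullary using (contradiction)
open import Function using (_∘_)

[m+n]%o≡m%o⇒o∣n : ∀ m n o .{{_ : NonZero o}} → (m + n) % o ≡ m % o → o ∣ n
[m+n]%o≡m%o⇒o∣n m n o eq = divides ((m + n) / o ∸ m / o) (begin
  n                                                   ≡⟨ m+n∸m≡n m n ⟨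
  m + n ∸ m                                           ≡⟨ cong₂ _∸_ (m≡m%n+[m/n]*n (m + n) o) (m≡m%n+[m/n]*n m o) ⟩
  (m + n) % o + (m + n) / o * o ∸ (m % o + m / o * o) ≡⟨ cong (λ t → t + (m + n) / o * o ∸ (m % o + m / o * o)) eq ⟩
  m % o + (m + n) / o * o ∸ (m % o + m / o * o)       ≡⟨ [m+n]∸[m+o]≡n∸o (m % o) _ _ ⟩
  (m + n) / o * o ∸ m / o * o                         ≡⟨ *-distribʳ-∸ o ((m + n) / o) (m / o) ⟨
  ((m + n) / o ∸ m / o) * o                           ∎)
  where open ≡-Reasoning

[m+n]%o≡m%o∧n<o⇒n≡0 : ∀ m {n o} .{{_ : NonZero o}} → n < o → (m + n) % o ≡ m % o → n ≡ 0
[m+n]%o≡m%o∧n<o⇒n≡0 m {zero}      _   _  = refl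
[m+n]%o≡m%o∧n<o⇒n≡0 m {n@(suc _)} {o} n<o eq = contradiction ([m+n]%o≡m%o⇒o∣n m n o eq) (>⇒∤ n<o)

m≤n<m+o∧n%o≡m%o⇒n≡m : ∀ {m n o} .{{_ : NonZero o}} → m ≤ n → n < m + o → n % o ≡ m % o → n ≡ m
m≤n<m+o∧n%o≡m%o⇒n≡m {m} {n} {o} m≤n n<m+o eq = begin
  n           ≡⟨ m+[n∸m]≡n m≤n ⟨
  m + (n ∸ m) ≡⟨ cong (m +_) n∸m≡0 ⟩
  m + 0       ≡⟨ +-identityʳ m ⟩
  m           ∎
  where
  open ≡-Reasoning
  n∸m≡0 : n ∸ m ≡ 0
  n∸m≡0 = [m+n]%o≡m%o∧n<o⇒n≡0 m (m<n+o⇒m∸n<o n m n<m+o) (trans (cong (_% o) (m+[n∸m]≡n m≤n)) eq)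

%-injective-window : ∀ {m n o} .{{_ : NonZero o}} → m < n + o → n < m + o → m % o ≡ n % o → m ≡ n
%-injective-window {m} {n} m<n+o n<m+o eq with ≤-total m n
... | inj₁ m≤n = sym (m≤n<m+o∧n%o≡m%o⇒n≡m m≤n n<m+o (sym eq))
... | inj₂ n≤m = m≤n<m+o∧n%o≡m%o⇒n≡m n≤m m<n+o eq

record Straddles (n b x y : ℕ) : Set where
  field
    low≤b      : x ≤ b
    b<high     : b < y
    high≤n     : y ≤ n
    high<low+n : y < x + n

open Straddles

low<high : ∀ {n b x y x' y'} → Straddles n b x y → Straddles n b x' y' → x < y'
low<high S S' = ≤-<-trans (low≤b S) (b<high S')

low<n : ∀ {n b x y} → Straddles n b x y → x < n
low<n S = <-≤-trans (low<high S S) (high≤n S)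

both-chords-straddle : ∀ {n b x y} → x < b → b < y → y < n →
                       Straddles n b x y × Straddles n b (suc x) (suc y)
both-chords-straddle {n} {x = x} {y} x<b b<y y<n =
  record { low≤b = <⇒≤ x<b ; b<high = b<y ; high≤n = <⇒≤ y<n ; high<low+n = y<x+n } ,
  record { low≤b = x<b ; b<high = m<n⇒m<1+n b<y ; high≤n = y<n ; high<low+n = s≤s y<x+n }
  where
  y<x+n : y < x + n
  y<x+n = <-≤-trans y<n (m≤n+m n x)

module _ {V : Set} {n : ℕ} (T : Tour V n) where
  open Tour T

  private instance
    n≢0 : NonZero n
    n≢0 = >-nonZero (≤-trans (s≤s z≤n) three≤n)

  offsetChord : ℕ → ℕ → ℕ → Edge T
  offsetChord a x y = (at T (a + x) , at T (a + y))

  at-≡⇒%-≡ : ∀ p q → at T p ≡ at T q → p % n ≡ q % n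
  at-≡⇒%-≡ p q eq = trans (sym (toℕ-fromℕ< _)) (trans (cong toℕ (inj eq)) (toℕ-fromℕ< _))

  at-injective-window : ∀ a {x y} → x < y + n → y < x + n → at T (a + x) ≡ at T (a + y) → x ≡ y
  at-injective-window a x<y+n y<x+n eq =
    +-cancelˡ-≡ a _ _ (%-injective-window (shift x<y+n) (shift y<x+n) (at-≡⇒%-≡ _ _ eq))
    where
    shift : ∀ {u v} → u < v + n → a + u < a + v + n
    shift {u} {v} u<v+n = subst (a + u <_) (sym (+-assoc a v n)) (+-monoʳ-< a u<v+n)

  at-window-≢ : ∀ a {x y} → x < y → y < x + n → at T (a + x) ≢ at T (a + y)
  at-window-≢ a x<y y<x+n eq = <⇒≢ x<y (at-injective-window a (m≤n⇒m≤n+o n x<y) y<x+n eq)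

  straddling-chords-≐ : ∀ a {b x y x' y'} → Straddles n b x y → Straddles n b x' y' →
                        _≐_ T (offsetChord a x y) (offsetChord a x' y') → x ≡ x' × y ≡ y'
  straddling-chords-≐ a {x' = x'} S S' (inj₁ (eq₁ , eq₂)) =
      at-injective-window a (<-≤-trans (low<n S) (m≤n+m n x')) (<-≤-trans (low<n S') (m≤n+m n _)) eq₁
    , at-injective-window a (≤-<-trans (high≤n S) (m<n+m n (≤-<-trans z≤n (b<high S'))))
                            (≤-<-trans (high≤n S') (m<n+m n (≤-<-trans z≤n (b<high S)))) eq₂
  -- Offsets 0 and n name the same vertex; when x = 0 the other pair of endpoints is compared.
  straddling-chords-≐ a {x = zero} {x' = x'} S S' (inj₂ (_ , eq₂)) =
    contradiction (sym eq₂) (at-window-≢ a (low<high S' S) (<-≤-trans (high<low+n S) (m≤n+m n x')))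
  straddling-chords-≐ a {x = suc x} S S' (inj₂ (eq₁ , _)) =
    contradiction eq₁ (at-window-≢ a (low<high S S') (s≤s (≤-trans (high≤n S') (m≤n+m n x))))

  ∈-chords : ∀ a {x y c} → c ∈ chords T (a + x) (a + y) →
             c ≡ offsetChord a x y ⊎ c ≡ offsetChord a (suc x) (suc y)
  ∈-chords a         (here refl)         = inj₁ refl
  ∈-chords a {x} {y} (there (here refl)) = inj₂ (cong₂ _,_ (cong (at T) (sym (+-suc a x)))
                                                            (cong (at T) (sym (+-suc a y))))

  straddling-2-changes-chordDisjoint :
    ∀ a {b x y x' y'} → x < b → b < y → y < n → x' < b → b < y' → y' < n →
    (x , y) ≢ (x' , y') → y ≢ suc y' → suc y ≢ y' →
    ChordDisjoint T (a + x) (a + y) (a + x') (a + y')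
  straddling-2-changes-chordDisjoint a x<b b<y y<n x'<b b<y' y'<n xy≢x'y' y≢1+y' 1+y≢y' c c' c∈ c'∈ c≐c'
    with ∈-chords a c∈ | ∈-chords a c'∈
       | both-chords-straddle x<b b<y y<n | both-chords-straddle x'<b b<y' y'<n
  ... | inj₁ refl | inj₁ refl | first , _ | first' , _ =
    let (x≡x' , y≡y') = straddling-chords-≐ a first first' c≐c' in xy≢x'y' (cong₂ _,_ x≡x' y≡y')
  ... | inj₁ refl | inj₂ refl | first , _ | _ , second' =
    y≢1+y' (proj₂ (straddling-chords-≐ a first second' c≐c'))
  ... | inj₂ refl | inj₁ refl | _ , second | first' , _ =
    1+y≢y' (proj₂ (straddling-chords-≐ a second first' c≐c'))
  ... | inj₂ refl | inj₂ refl | _ , second | _ , second' =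
    let (x≡x' , y≡y') = straddling-chords-≐ a second second' c≐c'
    in xy≢x'y' (cong₂ _,_ (suc-injective x≡x') (suc-injective y≡y'))

T₂-offset : ℕ → ℕ → ℕ
T₂-offset k s = suc (2 * (k + s))

T₂-position : ∀ a k s → a + 2 * k + 2 * s + 1 ≡ a + T₂-offset k s
T₂-position a k s = begin
  a + 2 * k + 2 * s + 1     ≡⟨ +-comm _ 1 ⟩
  suc (a + 2 * k + 2 * s)   ≡⟨ cong suc (+-assoc a (2 * k) (2 * s)) ⟩
  suc (a + (2 * k + 2 * s)) ≡⟨ cong (λ t → suc (a + t)) (*-distribˡ-+ 2 k s) ⟨
  suc (a + 2 * (k + s))     ≡⟨ +-suc a _ ⟨
  a + T₂-offset k s         ∎
  where open ≡-Reasoning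

2k<T₂-offset : ∀ k s → 2 * k < T₂-offset k s
2k<T₂-offset k s = s≤s (*-monoʳ-≤ 2 (m≤m+n k s))

T₂-offset<n : ∀ k {m n s} → s < m → 2 * k + 2 * m ≤ n → T₂-offset k s < n
T₂-offset<n k {m} {n} {s} s<m 2k+2m≤n = begin-strict
  T₂-offset k s         <⟨ n<1+n _ ⟩
  2 + 2 * (k + s)       ≡⟨ *-suc 2 (k + s) ⟨
  2 * suc (k + s)       ≤⟨ *-monoʳ-≤ 2 (+-monoʳ-< k s<m) ⟩
  2 * (k + m)           ≡⟨ *-distribˡ-+ 2 k m ⟩
  2 * k + 2 * m         ≤⟨ 2k+2m≤n ⟩
  n                     ∎
  where open ≤-Reasoning

T₂-offset-injective : ∀ k {s s'} → T₂-offset k s ≡ T₂-offset k s' → s ≡ s'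
T₂-offset-injective k eq = +-cancelˡ-≡ k _ _ (*-cancelˡ-≡ _ _ 2 (suc-injective eq))

T₂-offset≢1+T₂-offset : ∀ k s s' → T₂-offset k s ≢ suc (T₂-offset k s')
T₂-offset≢1+T₂-offset k s s' eq = even≢odd (k + s) (k + s') (suc-injective eq)

-- Non-adjacency only makes the 2-changes well defined; chord-disjointness does not need it.
lemma10 : {V : Set} {n : ℕ} (T : Tour V n) (a k m : ℕ) → 2 * k + 2 * m ≤ n →
          (r s r' s' : ℕ) → r < 2 * k → s < m → r' < 2 * k → s' < m →
          NonAdjacent T (a + r) (a + 2 * k + 2 * s + 1) →
          NonAdjacent T (a + r') (a + 2 * k + 2 * s' + 1) →
          (r , s) ≢ (r' , s') →
          ChordDisjoint T (a + r) (a + 2 * k + 2 * s + 1) (a + r') (a + 2 * k + 2 * s' + 1)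
lemma10 T a k m 2k+2m≤n r s r' s' r<2k s<m r'<2k s'<m _ _ rs≢r's' =
  subst₂ (λ q q' → ChordDisjoint T (a + r) q (a + r') q')
         (sym (T₂-position a k s)) (sym (T₂-position a k s'))
         (straddling-2-changes-chordDisjoint T a
            r<2k  (2k<T₂-offset k s)  (T₂-offset<n k s<m 2k+2m≤n)
            r'<2k (2k<T₂-offset k s') (T₂-offset<n k s'<m 2k+2m≤n)
            (λ eq → rs≢r's' (cong₂ _,_ (cong proj₁ eq) (T₂-offset-injective k (cong proj₂ eq))))
            (T₂-offset≢1+T₂-offset k s s')
            (T₂-offset≢1+T₂-offset k s' s ∘ sym))
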